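{- Let $G$ be a connected graph and $v \in V(G)$. If $v$ is neither a pendent vertex nor a cut-vertex of $G$, then $md(G) \le md(G - v)$.
   Context: A pendent vertex is a vertex of degree 1. An edge-coloring of a graph $G$ is a map $\Gamma: E(G) \to [k]$ (adjacent edges may receive the same color). An edge-cut is monochromatic if all of its edges have the same color. An edge-coloring is a monochromatic disconnection coloring (MD-coloring) if any two distinct vertices $u,v$ are separated by a monochromatic edge-cut (equivalently, for some color $i$, $u$ and $v$ lie in different components of the graph obtained by deleting all edges of color $i$). For a connected graph $G$, $md(G)$ is the maximum number of colors in an MD-coloring of $G$. -}

module Defs where

open import Data.Nat using (ℕ; suc; _≤_)
open import Data.Fin using (Fin; punchIn)
open import Data.Bool using (Bool; true; false; if_then_else_)
open import Data.List using (allFin; map)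
open import Data.Nat.ListAction using (sum)
open import Data.Product using (Σ; ∃; _×_; _,_)
open import Data.Unit using (⊤)
open import Relation.Binary.PropositionalEquality using (_≡_; _≢_)
open import Relation.Nullary using (¬_)

record Graph (n : ℕ) : Set where
  field
    Adj    : Fin n → Fin n → Bool
    sym    : ∀ i j → Adj i j ≡ Adj j i
    irrefl : ∀ i → Adj i i ≡ false
open Graph public

data Reach {n : ℕ} (G : Graph n) (P : Fin n → Fin n → Set) (u : Fin n) : Fin n → Set where
  here : Reach G P u u
  step : ∀ {x y} → Reach G P u x → Adj G x y ≡ true → P x y → Reach G P u y

Connected : {n : ℕ} → Graph n → Set
Connected {n} G = (u w : Fin n) → Reach G (λ _ _ → ⊤) u w

degree : {n : ℕ} → Graph n → Fin n → ℕ
degree {n} G v = sum (map (λ j → if Adj G v j then 1 else 0) (allFin n))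

Pendent : {n : ℕ} → Graph n → Fin n → Set
Pendent G v = degree G v ≡ 1

delete : {m : ℕ} → Graph (suc m) → Fin (suc m) → Graph m
delete G v = record
  { Adj    = λ i j → Adj G (punchIn v i) (punchIn v j)
  ; sym    = λ i j → sym G (punchIn v i) (punchIn v j)
  ; irrefl = λ i → irrefl G (punchIn v i) }

-- For a connected graph G, v is a cut-vertex iff G - v is disconnected.
CutVertex : {m : ℕ} → Graph (suc m) → Fin (suc m) → Set
CutVertex G v = ¬ Connected (delete G v)

-- An edge-coloring with colors Fin k: a value Γ x y for each edge {x,y}
-- (only values on edges matter; symmetric on edges so it is a map on E(G)).
record EdgeColoring {n : ℕ} (G : Graph n) (k : ℕ) : Set where
  field
    col     : Fin n → Fin n → Fin k
    col-sym : ∀ x y → Adj G x y ≡ true → col x y ≡ col y x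
open EdgeColoring public

-- the coloring uses all k colors (so it uses exactly k colors)
UsesAll : {n k : ℕ} {G : Graph n} → EdgeColoring G k → Set
UsesAll {n} {k} {G} Γ = (c : Fin k) → ∃ λ x → ∃ λ y → Adj G x y ≡ true × col Γ x y ≡ c

-- u and w are separated by the monochromatic edge-cut of color c:
-- they are disconnected in G minus all edges of color c.
SeparatedBy : {n k : ℕ} {G : Graph n} → EdgeColoring G k → Fin k → Fin n → Fin n → Set
SeparatedBy {G = G} Γ c u w = ¬ Reach G (λ x y → col Γ x y ≢ c) u w

IsMD : {n k : ℕ} {G : Graph n} → EdgeColoring G k → Set
IsMD {n} {k} Γ = (u w : Fin n) → u ≢ w → ∃ λ (c : Fin k) → SeparatedBy Γ c u w

HasMD : {n : ℕ} → Graph n → ℕ → Set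
HasMD G k = Σ (EdgeColoring G k) (λ Γ → UsesAll Γ × IsMD Γ)

-- md(G) ≤ md(H), unfolded via md = maximum number of colors of an MD-coloring:
-- every achievable number of colors for G is bounded by one achievable for H.
MdLe : {n m : ℕ} → Graph n → Graph m → Set
MdLe G H = ∀ k → HasMD G k → ∃ λ k' → HasMD H k' × k ≤ k'

module Submission where

-- Let Γ be an MD-coloring of G with exactly k colours.  Its
-- restriction Γ' to G - v is again an MD-coloring: a path of G - v avoiding a
-- colour is also such a path in G, so every separating cut of G restricts to
-- one of G - v.  The real content is that Γ' still uses all k colours.
-- Suppose colour c occurs only on edges at v, say on the edge vu.  Since G - v
-- is connected (v is no cut-vertex), any two vertices other than v are joined
-- by a path avoiding c.  The only colour that can separate the ends of a
-- monochromatic path is its own colour, so c separates v from u.  Since v is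
-- not pendent it has a second neighbour u₂ ≠ u.  If vu₂ does not have colour
-- c, the walk v u₂ ⋯ u avoids c; if it does, the monochromatic path u v u₂
-- forces c to separate u from u₂, yet they are joined avoiding c in G - v.

open import Defs
open import Data.Nat using (ℕ; suc; zero)
open import Data.Nat.Properties using (≤-refl)
open import Data.Fin using (Fin; punchIn; punchOut; _≟_)
open import Data.Fin.Properties using (punchIn-injective; punchIn-punchOut; punchInᵢ≢i; any?; suc-injective)
open import Data.Bool using (true; false; if_then_else_)
import Data.Bool.Properties as Bool
open import Data.List using (tabulate)
open import Data.List.Properties using (map-tabulate)
open import Data.Nat.ListAction using (sum)
open import Data.Product using (∃; _×_; _,_)
open import Data.Empty using (⊥; ⊥-elim)
open import Relation.Binary.PropositionalEquality using (_≡_; _≢_; refl; trans; cong) renaming (sym to ≡-sym)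
open import Relation.Nullary using (¬_; Dec; yes; no)
open import Relation.Nullary.Decidable using (_×-dec_; ¬?)
open import Function using (_∘_)
open import Relation.Nullary.Negation using (contradiction)

sum-zeros : ∀ {n} (h : Fin n → ℕ) → (∀ j → h j ≡ 0) → sum (tabulate h) ≡ 0
sum-zeros {zero}  h zeros = refl
sum-zeros {suc n} h zeros
  rewrite zeros Fin.zero = sum-zeros (λ j → h (Fin.suc j)) (λ j → zeros (Fin.suc j))

sum-single-one : ∀ {n} (h : Fin n → ℕ) (u : Fin n) →
                 h u ≡ 1 → (∀ j → j ≢ u → h j ≡ 0) → sum (tabulate h) ≡ 1
sum-single-one {suc n} h Fin.zero hu zeros rewrite hu =
  cong suc (sum-zeros (λ j → h (Fin.suc j)) (λ j → zeros (Fin.suc j) (λ ())))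
sum-single-one {suc n} h (Fin.suc u) hu zeros rewrite zeros Fin.zero (λ ()) =
  sum-single-one (λ j → h (Fin.suc j)) u hu
    (λ j j≢u → zeros (Fin.suc j) (λ e → j≢u (suc-injective e)))

degree-unique-neighbour : ∀ {n} (G : Graph n) (v u : Fin n) → Adj G v u ≡ true →
                          (∀ w → Adj G v w ≡ true → w ≡ u) → Pendent G v
degree-unique-neighbour {n} G v u vu only =
  trans (cong sum (map-tabulate (λ j → j) indicator))
        (sum-single-one indicator u (cong (λ b → if b then 1 else 0) vu) off-u)
  where
  indicator : Fin n → ℕ
  indicator j = if Adj G v j then 1 else 0

  off-u : ∀ j → j ≢ u → indicator j ≡ 0
  off-u j j≢u with Adj G v j in vj
  ... | true  = contradiction (only j vj) j≢u
  ... | false = refl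

second-neighbour : ∀ {n} (G : Graph n) (v u : Fin n) → ¬ Pendent G v →
                   Adj G v u ≡ true → ∃ λ w → Adj G v w ≡ true × w ≢ u
second-neighbour G v u not-pendent vu
  with any? (λ w → (Adj G v w Bool.≟ true) ×-dec (¬? (w ≟ u)))
... | yes found = found
... | no none = contradiction (degree-unique-neighbour G v u vu only-u) not-pendent
  where
  only-u : ∀ w → Adj G v w ≡ true → w ≡ u
  only-u w vw with w ≟ u
  ... | yes w≡u = w≡u
  ... | no  w≢u = contradiction (w , vw , w≢u) none

neighbour-≢ : ∀ {n} (G : Graph n) {v u : Fin n} → Adj G v u ≡ true → u ≢ v
neighbour-≢ G {v} vu refl with trans (≡-sym vu) (irrefl G v)
... | ()

Reach-trans : ∀ {n} {G : Graph n} {P} {a b c} → Reach G P a b → Reach G P b c → Reach G P a c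
Reach-trans r here         = r
Reach-trans r (step s e p) = step (Reach-trans r s) e p

Reach-map : ∀ {n n'} {G : Graph n} {H : Graph n'} {P Q} (f : Fin n → Fin n') →
            (∀ {x y} → Adj G x y ≡ true → P x y → Adj H (f x) (f y) ≡ true × Q (f x) (f y)) →
            ∀ {a b} → Reach G P a b → Reach H Q (f a) (f b)
Reach-map f edge here = here
Reach-map f edge (step r e p) with edge e p
... | e' , q = step (Reach-map f edge r) e' q

Avoid : ∀ {n k} {G : Graph n} → EdgeColoring G k → Fin k → Fin n → Fin n → Set
Avoid Γ c x y = col Γ x y ≢ c

-- The only colour that can separate the ends of a walk all of whose edges
-- have colour c is c itself: for c' ≢ c the walk itself avoids c'.
monochromatic-separator : ∀ {n k} {G : Graph n} (Γ : EdgeColoring G k) {c c' : Fin k} {a b} →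
                          Reach G (λ x y → col Γ x y ≡ c) a b → SeparatedBy Γ c' a b → c' ≡ c
monochromatic-separator Γ {c} {c'} walk separated with c' ≟ c
... | yes c'≡c = c'≡c
... | no  c'≢c = contradiction (Reach-map (λ x → x) (λ e cxy → e , λ e' → c'≢c (trans (≡-sym e') cxy)) walk)
                               separated

restrict : ∀ {m k} (G : Graph (suc m)) (v : Fin (suc m)) → EdgeColoring G k → EdgeColoring (delete G v) k
restrict G v Γ = record
  { col     = λ x y → col Γ (punchIn v x) (punchIn v y)
  ; col-sym = λ x y e → col-sym Γ (punchIn v x) (punchIn v y) e }

-- Restriction preserves MD-colorings: a walk of G - v avoiding c is one of G.
restrict-isMD : ∀ {m k} (G : Graph (suc m)) (v : Fin (suc m)) (Γ : EdgeColoring G k) →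
                IsMD Γ → IsMD (restrict G v Γ)
restrict-isMD G v Γ md a b a≢b with md (punchIn v a) (punchIn v b) (a≢b ∘ punchIn-injective v a b)
... | c , separated = c , λ walk → separated (Reach-map (punchIn v) (λ e p → e , p) walk)

ConfinedTo : ∀ {n k} {G : Graph n} → EdgeColoring G k → Fin k → Fin n → Set
ConfinedTo {G = G} Γ c v = ∀ x y → x ≢ v → y ≢ v → Adj G x y ≡ true → col Γ x y ≢ c

punchIn-onto : ∀ {m} (v x : Fin (suc m)) → x ≢ v → ∃ λ x' → punchIn v x' ≡ x
punchIn-onto v x x≢v = punchOut (λ v≡x → x≢v (≡-sym v≡x)) , punchIn-punchOut (λ v≡x → x≢v (≡-sym v≡x))

confined-avoidable : ∀ {m k} (G : Graph (suc m)) (v : Fin (suc m)) (Γ : EdgeColoring G k) {c : Fin k} →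
                     Connected (delete G v) → ConfinedTo Γ c v →
                     ∀ a b → a ≢ v → b ≢ v → Reach G (Avoid Γ c) a b
confined-avoidable G v Γ connected confined a b a≢v b≢v
  with punchIn-onto v a a≢v | punchIn-onto v b b≢v
... | a' , refl | b' , refl =
  Reach-map (punchIn v)
    (λ {x} {y} e _ → e , confined (punchIn v x) (punchIn v y) (punchInᵢ≢i v x) (punchInᵢ≢i v y) e)
    (connected a' b')

confined-edge : ∀ {n k} {G : Graph n} (Γ : EdgeColoring G k) {c : Fin k} {v : Fin n} →
                UsesAll Γ → ConfinedTo Γ c v → ∃ λ u → Adj G v u ≡ true × col Γ v u ≡ c
confined-edge {G = G} Γ {c} {v} uses confined with uses c
... | x , y , xy , cxy with x ≟ v | y ≟ v
... | yes refl | _        = y , xy , cxy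
... | no  _    | yes refl = x , trans (Graph.sym G v x) xy , trans (≡-sym (col-sym Γ x v xy)) cxy
... | no  x≢v  | no  y≢v  = contradiction cxy (confined x y x≢v y≢v xy)

colour-not-confined : ∀ {n k} (G : Graph n) (Γ : EdgeColoring G k) (v u : Fin n) {c : Fin k} →
                      IsMD Γ → ¬ Pendent G v →
                      (∀ a b → a ≢ v → b ≢ v → Reach G (Avoid Γ c) a b) →
                      Adj G v u ≡ true → col Γ v u ≡ c → ⊥
colour-not-confined G Γ v u {c} md not-pendent avoidable vu cvu
  with second-neighbour G v u not-pendent vu
... | u₂ , vu₂ , u₂≢u = by-colour-of-vu₂ (col Γ v u₂ ≟ c)
  where
  u≢v  = neighbour-≢ G vu
  u₂≢v = neighbour-≢ G vu₂

  c-separates-v-u : SeparatedBy Γ c v u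
  c-separates-v-u with md v u (λ v≡u → u≢v (≡-sym v≡u))
  ... | c' , separated with monochromatic-separator Γ (step here vu cvu) separated
  ...   | refl = separated

  by-colour-of-vu₂ : Dec (col Γ v u₂ ≡ c) → ⊥
  by-colour-of-vu₂ (no cvu₂≢c) =
    c-separates-v-u (Reach-trans (step here vu₂ cvu₂≢c) (avoidable u₂ u u₂≢v u≢v))
  by-colour-of-vu₂ (yes cvu₂) with md u u₂ (λ u≡u₂ → u₂≢u (≡-sym u≡u₂))
  ... | c' , separated with monochromatic-separator Γ (step (step here uv cuv) vu₂ cvu₂) separated
    where
    uv  = trans (Graph.sym G u v) vu
    cuv = trans (col-sym Γ u v uv) cvu
  ... | refl = separated (avoidable u u₂ u≢v u₂≢v)

restrict-usesAll : ∀ {m k} (G : Graph (suc m)) (v : Fin (suc m)) (Γ : EdgeColoring G k) →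
                   ¬ Pendent G v → ¬ CutVertex G v → UsesAll Γ → IsMD Γ →
                   UsesAll (restrict G v Γ)
restrict-usesAll G v Γ not-pendent not-cut uses md c
  with any? (λ x → any? (λ y → (Adj (delete G v) x y Bool.≟ true) ×-dec (col (restrict G v Γ) x y ≟ c)))
... | yes edge-off-v = edge-off-v
... | no  none = ⊥-elim (not-cut λ connected' →
  let u , vu , cvu = confined-edge Γ uses confined
  in colour-not-confined G Γ v u md not-pendent (confined-avoidable G v Γ connected' confined) vu cvu)
  where
  confined : ConfinedTo Γ c v
  confined x y x≢v y≢v xy cxy with punchIn-onto v x x≢v | punchIn-onto v y y≢v
  ... | x' , refl | y' , refl = none (x' , y' , xy , cxy)

lemma2p2 : {m : ℕ} (G : Graph (suc m)) (v : Fin (suc m)) →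
    Connected G → ¬ Pendent G v → ¬ CutVertex G v →
    MdLe G (delete G v)
lemma2p2 G v _ not-pendent not-cut k (Γ , uses , md) =
  k , (restrict G v Γ , restrict-usesAll G v Γ not-pendent not-cut uses md , restrict-isMD G v Γ md) , ≤-refl
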